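{- Let $\varepsilon,\eta\in(0,1)$, $\rho = c\log n/\varepsilon^2$ for a sufficiently large constant $c$, and let $V_{sparse},C_1,\dots,C_k$ be an $(\eta,\varepsilon,\delta)$-almost-clique decomposition of an $n$-vertex graph $G$ of maximum degree $\Delta$. Suppose a one-pass streaming algorithm has, after the pass, recovered the sets $A(v)$ and $E(v)$ for every vertex $v\notin V_{sparse}$ with $a(v)+e(v)\le 4\rho$. Let $C$ be a critical almost-clique of the decomposition that is not solitary, with core $K$. Then from this information one recovers $K$ and $N(v)\cap K$ for all vertices $v\in V$.
   Context: For $\varepsilon,\delta\in(0,1)$, a set $C\subseteq V$ is an $(\varepsilon,\delta)$-almost-clique if (1) $(1-\varepsilon/2)\Delta\le|C|\le(1+\varepsilon/2)\Delta$; (2) $|C-N[v]|,|N(v)-C|\le\varepsilon\Delta$ for all $v\in C$; (3) every $v\notin C$ has $|C-N(v)|\ge\delta\Delta$. A vertex $v$ is $\zeta$-sparse if $G[N(v)]$ has at most $\binom{\Delta}{2}-\zeta\Delta$ edges. An $(\eta,\varepsilon,\delta)$-almost-clique decomposition is a partition $V=V_{sparse}\cup C_1\cup\dots\cup C_k$ where every $v\in V_{sparse}$ is $\eta\varepsilon^2\Delta$-sparse and each $C_i$ is an $(\varepsilon,\delta)$-almost-clique. For $v$ in almost-clique $C$: $E(v)=N(v)-C$, $e(v)=|E(v)|$, $A(v)=C-N[v]$, $a(v)=|A(v)|$. An almost-clique $C$ is large if $|C|\ge\Delta+1$, small if $|C|\le\Delta+1-\rho$, and critical otherwise. The core of $C$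 is a set $K\subseteq C$ inducing a clique of maximum size in $G[C]$; $C$ is solitary if its core has size at most $|C|-2$. The almost-clique decomposition itself is known after the pass.
   Formalization: The parameters ε, η and δ are rational, and an arbitrary rational ρ takes the place of $\rho = c\log n/\varepsilon^2$. -}

module Defs where

open import Data.Nat as ℕ using (ℕ; zero; suc; _⊔_; _<ᵇ_)
import Data.Nat.Combinatorics as Comb
open import Data.Integer using (+_)
open import Data.Rational using (ℚ; _/_; _*_; _-_; _+_; _≤_; _<_; 1ℚ; ½)
open import Data.Bool using (Bool; true; false; if_then_else_; _∧_)
open import Data.Fin using (Fin; toℕ)
open import Data.Fin.Subset using (Subset; Side; inside; outside; _∈_; _∉_; _⊆_; ⁅_⁆; _∩_; _∪_; _─_; ∣_∣)
open import Data.Vec using (Vec; tabulate; foldr; lookup)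
open import Data.Maybe using (Maybe; just; nothing)
open import Data.Product using (Σ; _×_; _,_; ∃)
open import Relation.Binary.PropositionalEquality using (_≡_; _≢_)
open import Relation.Nullary using (¬_)

⟦_⟧ : ℕ → ℚ
⟦ m ⟧ = + m / 1

record Graph (n : ℕ) : Set where
  field
    adj    : Fin n → Fin n → Bool
    sym    : ∀ u v → adj u v ≡ adj v u
    irrefl : ∀ v → adj v v ≡ false
open Graph public

toSide : Bool → Side
toSide b = if b then inside else outside

fromPred : ∀ {n} → (Fin n → Bool) → Subset n
fromPred f = tabulate (λ v → toSide (f v))

module _ {n : ℕ} (G : Graph n) where

  N : Fin n → Subset n
  N v = fromPred (adj G v)

  N[_] : Fin n → Subset n
  N[ v ] = N v ∪ ⁅ v ⁆

  deg : Fin n → ℕ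
  deg v = ∣ N v ∣

  maxDegree : ℕ
  maxDegree = foldr (λ _ → ℕ) _⊔_ 0 (tabulate deg)

  -- number of edges of the induced subgraph G[S]: pairs {u,w} with u < w, both in S, adjacent
  edgeCount : Subset n → ℕ
  edgeCount S = foldr (λ _ → ℕ) ℕ._+_ 0
    (tabulate (λ u → if isIn u then ∣ (N u ∩ S) ∩ fromPred (λ w → toℕ u <ᵇ toℕ w) ∣ else 0))
    where
      isIn : Fin n → Bool
      isIn u with lookup S u
      ... | inside  = true
      ... | outside = false

  IsSparse : (Δ : ℕ) → (ζ : ℚ) → Fin n → Set
  IsSparse Δ ζ v = ⟦ edgeCount (N v) ⟧ ≤ ⟦ Δ Comb.C 2 ⟧ - ζ * ⟦ Δ ⟧

  record IsAlmostClique (Δ : ℕ) (ε δ : ℚ) (C : Subset n) : Set where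
    field
      size-lower : (1ℚ - ε * ½) * ⟦ Δ ⟧ ≤ ⟦ ∣ C ∣ ⟧
      size-upper : ⟦ ∣ C ∣ ⟧ ≤ (1ℚ + ε * ½) * ⟦ Δ ⟧
      anti-deg   : ∀ v → v ∈ C → ⟦ ∣ C ─ N[ v ] ∣ ⟧ ≤ ε * ⟦ Δ ⟧
      ext-deg    : ∀ v → v ∈ C → ⟦ ∣ N v ─ C ∣ ⟧ ≤ ε * ⟦ Δ ⟧
      outsiders  : ∀ v → v ∉ C → δ * ⟦ Δ ⟧ ≤ ⟦ ∣ C ─ N v ∣ ⟧

  Eset : Subset n → Fin n → Subset n
  Eset C v = N v ─ C

  Aset : Subset n → Fin n → Subset n
  Aset C v = C ─ N[ v ]

  Large : (Δ : ℕ) → Subset n → Set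
  Large Δ C = suc Δ ℕ.≤ ∣ C ∣

  Small : (Δ : ℕ) (ρ : ℚ) → Subset n → Set
  Small Δ ρ C = ⟦ ∣ C ∣ ⟧ ≤ ⟦ suc Δ ⟧ - ρ

  Critical : (Δ : ℕ) (ρ : ℚ) → Subset n → Set
  Critical Δ ρ C = ¬ Large Δ C × ¬ Small Δ ρ C

  IsClique : Subset n → Set
  IsClique S = ∀ u v → u ∈ S → v ∈ S → u ≢ v → adj G u v ≡ true

  IsCore : Subset n → Subset n → Set
  IsCore C K = K ⊆ C × IsClique K × (∀ K′ → K′ ⊆ C → IsClique K′ → ∣ K′ ∣ ℕ.≤ ∣ K ∣)

  Solitary : Subset n → Set
  Solitary C = ∃ λ K → IsCore C K × (∣ K ∣ ℕ.+ 2 ℕ.≤ ∣ C ∣)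

-- An almost-clique decomposition is encoded by a labelling: label v = nothing means v ∈ V_sparse,
-- label v = just i means v ∈ C_i.  This is exactly a partition V = V_sparse ∪ C_1 ∪ … ∪ C_k.
Labelling : ℕ → ℕ → Set
Labelling n k = Fin n → Maybe (Fin k)

labelIs : ∀ {k} → Maybe (Fin k) → Fin k → Bool
labelIs nothing  i = false
labelIs (just j) i = ⌊ j Data.Fin.≟ i ⌋
  where open import Relation.Nullary.Decidable using (⌊_⌋)
        import Data.Fin

cluster : ∀ {n k} → Labelling n k → Fin k → Subset n
cluster label i = fromPred (λ v → labelIs (label v) i)

record IsACD {n k : ℕ} (G : Graph n) (Δ : ℕ) (η ε δ : ℚ) (label : Labelling n k) : Set where
  field
    sparse-part : ∀ v → label v ≡ nothing → IsSparse G Δ (η * ε * ε * ⟦ Δ ⟧) v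
    clique-part : ∀ i → IsAlmostClique G Δ ε δ (cluster label i)

-- Recovered information: for every v ∉ V_sparse (v ∈ C_i) with a(v) + e(v) ≤ 4ρ,
-- the stored entry is (A(v), E(v)).  Other entries are unconstrained.
Recovered : ∀ {n k} → Graph n → Labelling n k → ℚ → (Fin n → Maybe (Subset n × Subset n)) → Set
Recovered {n} G label ρ rec =
  ∀ (v : Fin n) i → label v ≡ just i →
    let C = cluster label i in
    ⟦ ∣ Aset G C v ∣ ℕ.+ ∣ Eset G C v ∣ ⟧ ≤ ⟦ 4 ⟧ * ρ →
    rec v ≡ just (Aset G C v , Eset G C v)

{-# OPTIONS --safe #-}
-- Let K₀ be a core of C.  As C is not solitary, C − K₀ has at most one vertex, so every
-- v ∈ K₀ has a(v) ≤ 1, and counting N(v) ∪ C gives e(v) + |C| ≤ deg v + 1 + a(v); as C is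
-- critical, Δ + 1 − |C| < ρ, hence a(v) + e(v) ≤ 4ρ and the reports of all vertices of K₀
-- are stored.  A report (A(u), E(u)) determines N(u) = (C − (A(u) ∪ {u})) ∪ E(u).  Call u, w
-- reported-adjacent when each lies in the neighbourhood the other's report determines.  K₀ is
-- a reported clique, and every reported clique inside C is a genuine clique, because of two of
-- its vertices at least one lies in K₀ and reports truthfully.  So a maximum reported clique in
-- C is a core K, its vertices again report truthfully, and their reports give N(v) ∩ K.
module Submission where

open import Defs hiding (sym)
open import Data.Bool using (Bool; true; false; _∧_)
open import Data.Bool.Properties using (∧-conicalˡ; ∧-conicalʳ; ∧-zeroʳ)
open import Data.Fin using (Fin; zero; suc; _≟_)
open import Data.Fin.Properties using (all?)
open import Data.Fin.Subset
  using (Subset; inside; outside; _∈_; _∉_; _⊆_; ⁅_⁆; _∩_; _∪_; _─_; ∣_∣; ⊥; Empty)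
open import Data.Fin.Subset.Properties
  using ( _∈?_; _⊆?_; anySubset?; drop-there; drop-∷-Empty; ⊥⊆; ∉⊥; ∣p∣≤n; p⊆q⇒∣p∣≤∣q∣
        ; x∈⁅x⁆; x∈⁅y⁆⇒x≡y; ∣⁅x⁆∣≡1; x∈p∩q⁻; x∈p∪q⁺; x∈p∪q⁻; x∈p∧x∉q⇒x∈p─q; ∣p─q∣≤∣p∣
        ; x∈p∧x≢y⇒x∈p-y; x∈p⇒∣p-x∣<∣p∣ )
open import Data.Integer as ℤ using (+_)
import Data.Integer.Properties as ℤ
open import Data.Maybe using (Maybe; just; maybe′)
open import Data.Nat using (ℕ; zero; suc; z≤n; s≤s; _≤_; _<_; _+_; _*_; _∸_; _⊔_)
open import Data.Nat.Properties hiding (_≟_)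
import Data.Nat.Coprimality as Coprime
open import Data.Product using (Σ; _×_; _,_; proj₁; proj₂)
import Data.Product as Product
open import Data.Rational as ℚ using (ℚ; mkℚ; *≤*; _/_; 0ℚ; 1ℚ)
import Data.Rational.Properties as ℚ
open import Algebra.Properties.AbelianGroup ℚ.+-0-abelianGroup using (xyx⁻¹≈y)
open import Data.Sum using ([_,_]; inj₁; inj₂)
open import Data.Vec using (_∷_; []; here; there; lookup; tabulate; foldr)
open import Data.Vec.Properties using ([]=⇒lookup; lookup⇒[]=; lookup∘tabulate)
open import Function using (_∘_; id)
open import Relation.Binary.PropositionalEquality
  using (_≡_; _≢_; refl; sym; trans; cong; cong₂; subst; subst₂; module ≡-Reasoning)
open import Relation.Nullary using (¬_; yes; no; ¬?; contradiction)
open import Relation.Nullary.Decidable using (_×-dec_; _→-dec_)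
open import Relation.Unary using (Pred; Decidable)

⟦⟧≡mkℚ : ∀ m → ⟦ m ⟧ ≡ mkℚ (+ m) 0 (Coprime.sym (Coprime.1-coprimeTo m))
⟦⟧≡mkℚ m = ℚ.normalize-coprime _

⟦⟧-mono-≤ : ∀ {m n} → m ≤ n → ⟦ m ⟧ ℚ.≤ ⟦ n ⟧
⟦⟧-mono-≤ {m} {n} m≤n = subst₂ ℚ._≤_ (sym (⟦⟧≡mkℚ m)) (sym (⟦⟧≡mkℚ n))
  (*≤* (ℤ.*-monoʳ-≤-nonNeg (+ 1) (ℤ.+≤+ m≤n)))

⟦⟧-+ : ∀ m n → ⟦ m + n ⟧ ≡ ⟦ m ⟧ ℚ.+ ⟦ n ⟧
⟦⟧-+ m n = begin
  + (m + n) / 1                      ≡⟨ cong (_/ 1) (ℤ.pos-+ m n) ⟩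
  (+ m ℤ.+ + n) / 1                  ≡⟨ cong (_/ 1) (cong₂ ℤ._+_ (*1 m) (*1 n)) ⟨
  (+ m ℤ.* + 1 ℤ.+ + n ℤ.* + 1) / 1  ≡⟨ cong₂ ℚ._+_ (⟦⟧≡mkℚ m) (⟦⟧≡mkℚ n) ⟨
  ⟦ m ⟧ ℚ.+ ⟦ n ⟧                    ∎
  where
  open ≡-Reasoning
  *1 : ∀ k → + k ℤ.* + 1 ≡ + k
  *1 k = ℤ.*-identityʳ (+ k)

⟦⟧-* : ∀ m n → ⟦ m * n ⟧ ≡ ⟦ m ⟧ ℚ.* ⟦ n ⟧
⟦⟧-* m n = begin
  + (m * n) / 1        ≡⟨ cong (_/ 1) (ℤ.pos-* m n) ⟩
  (+ m ℤ.* + n) / 1    ≡⟨ cong₂ ℚ._*_ (⟦⟧≡mkℚ m) (⟦⟧≡mkℚ n) ⟨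
  ⟦ m ⟧ ℚ.* ⟦ n ⟧      ∎
  where open ≡-Reasoning

-- The two hypotheses put the deficit Δ + 1 − c in [1, ρ], and q ≤ deficit + 2 ≤ 4 · deficit.
≤deficit+2⇒≤4ρ : ∀ {Δ c q} {ρ : ℚ} → ¬ (suc Δ ≤ c) → ¬ (⟦ c ⟧ ℚ.≤ ⟦ suc Δ ⟧ ℚ.- ρ) →
                 q + c ≤ 3 + Δ → ⟦ q ⟧ ℚ.≤ ⟦ 4 ⟧ ℚ.* ρ
≤deficit+2⇒≤4ρ {Δ} {c} {q} {ρ} notLarge notSmall q+c≤3+Δ = begin
  ⟦ q ⟧              ≤⟨ ⟦⟧-mono-≤ (≤-trans q≤3+s 3+s≤4[1+s]) ⟩
  ⟦ 4 * suc s ⟧      ≡⟨ ⟦⟧-* 4 (suc s) ⟩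
  ⟦ 4 ⟧ ℚ.* ⟦ suc s ⟧ ≤⟨ ℚ.*-monoˡ-≤-nonNeg ⟦ 4 ⟧ deficit≤ρ ⟩
  ⟦ 4 ⟧ ℚ.* ρ        ∎
  where
  open ℚ.≤-Reasoning
  s : ℕ
  s = Δ ∸ c

  c≤Δ : c ≤ Δ
  c≤Δ = ≤-pred (≰⇒> notLarge)

  q≤3+s : q ≤ 3 + s
  q≤3+s = subst (q ≤_) (+-∸-assoc 3 c≤Δ) (m+n≤o⇒m≤o∸n q q+c≤3+Δ)

  3+s≤4[1+s] : 3 + s ≤ 4 * suc s
  3+s≤4[1+s] = subst (3 + s ≤_) (sym (*-suc 4 s)) (+-mono-≤ (n≤1+n 3) (m≤n*m s 4))

  deficit≤ρ : ⟦ suc s ⟧ ℚ.≤ ρ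
  deficit≤ρ = ℚ.≮⇒≥ λ ρ<deficit → notSmall (begin
    ⟦ c ⟧                              ≡⟨ xyx⁻¹≈y ⟦ suc s ⟧ ⟦ c ⟧ ⟨
    ⟦ suc s ⟧ ℚ.+ ⟦ c ⟧ ℚ.- ⟦ suc s ⟧    ≡⟨ cong (ℚ._- ⟦ suc s ⟧) (⟦⟧-+ (suc s) c) ⟨
    ⟦ suc s + c ⟧ ℚ.- ⟦ suc s ⟧         ≡⟨ cong (λ x → ⟦ suc x ⟧ ℚ.- ⟦ suc s ⟧) (m∸n+n≡m c≤Δ) ⟩
    ⟦ suc Δ ⟧ ℚ.- ⟦ suc s ⟧             ≤⟨ ℚ.+-monoʳ-≤ ⟦ suc Δ ⟧ (ℚ.neg-antimono-≤ (ℚ.<⇒≤ ρ<deficit)) ⟩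
    ⟦ suc Δ ⟧ ℚ.- ρ                    ∎)

lookup-fromPred : ∀ {n} (f : Fin n → Bool) x → lookup (fromPred f) x ≡ f x
lookup-fromPred f x = trans (lookup∘tabulate (toSide ∘ f) x) (toSide-id (f x))
  where
  toSide-id : ∀ b → toSide b ≡ b
  toSide-id true  = refl
  toSide-id false = refl

x∈p─q⁻ : ∀ {n} {x : Fin n} (p q : Subset n) → x ∈ p ─ q → x ∈ p × x ∉ q
x∈p─q⁻ (s ∷ p) (t ∷ q) (there x∈p─q) =
  Product.map there (_∘ drop-there) (x∈p─q⁻ p q x∈p─q)
x∈p─q⁻ (inside ∷ p) (outside ∷ q) here = here , λ ()

∩-cong-on : ∀ {n} (p q r : Subset n) → (∀ {x} → x ∈ r → lookup p x ≡ lookup q x) →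
            p ∩ r ≡ q ∩ r
∩-cong-on [] [] [] _ = refl
∩-cong-on (s ∷ p) (t ∷ q) (inside ∷ r) p≗q =
  cong₂ _∷_ (cong (_∧ true) (p≗q here)) (∩-cong-on p q r (p≗q ∘ there))
∩-cong-on (s ∷ p) (t ∷ q) (outside ∷ r) p≗q =
  cong₂ _∷_ (trans (∧-zeroʳ s) (sym (∧-zeroʳ t))) (∩-cong-on p q r (p≗q ∘ there))

p─[[p─q∪r]∪r]∪[q─p]≡q : ∀ {n} (p q r : Subset n) → Empty (q ∩ r) →
                        (p ─ ((p ─ (q ∪ r)) ∪ r)) ∪ (q ─ p) ≡ q
p─[[p─q∪r]∪r]∪[q─p]≡q [] [] [] _ = refl
p─[[p─q∪r]∪r]∪[q─p]≡q (s ∷ p) (inside ∷ q) (inside ∷ r) q∩r-empty =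
  contradiction (zero , here) q∩r-empty
p─[[p─q∪r]∪r]∪[q─p]≡q (inside ∷ p) (inside ∷ q) (outside ∷ r) q∩r-empty =
  cong (inside ∷_) (p─[[p─q∪r]∪r]∪[q─p]≡q p q r (drop-∷-Empty q∩r-empty))
p─[[p─q∪r]∪r]∪[q─p]≡q (outside ∷ p) (inside ∷ q) (outside ∷ r) q∩r-empty =
  cong (inside ∷_) (p─[[p─q∪r]∪r]∪[q─p]≡q p q r (drop-∷-Empty q∩r-empty))
p─[[p─q∪r]∪r]∪[q─p]≡q (inside ∷ p) (outside ∷ q) (inside ∷ r) q∩r-empty =
  cong (outside ∷_) (p─[[p─q∪r]∪r]∪[q─p]≡q p q r (drop-∷-Empty q∩r-empty))
p─[[p─q∪r]∪r]∪[q─p]≡q (inside ∷ p) (outside ∷ q) (outside ∷ r) q∩r-empty =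
  cong (outside ∷_) (p─[[p─q∪r]∪r]∪[q─p]≡q p q r (drop-∷-Empty q∩r-empty))
p─[[p─q∪r]∪r]∪[q─p]≡q (outside ∷ p) (outside ∷ q) (inside ∷ r) q∩r-empty =
  cong (outside ∷_) (p─[[p─q∪r]∪r]∪[q─p]≡q p q r (drop-∷-Empty q∩r-empty))
p─[[p─q∪r]∪r]∪[q─p]≡q (outside ∷ p) (outside ∷ q) (outside ∷ r) q∩r-empty =
  cong (outside ∷_) (p─[[p─q∪r]∪r]∪[q─p]≡q p q r (drop-∷-Empty q∩r-empty))

∣p∪q∣≡∣p─q∣+∣q∣ : ∀ {n} (p q : Subset n) → ∣ p ∪ q ∣ ≡ ∣ p ─ q ∣ + ∣ q ∣
∣p∪q∣≡∣p─q∣+∣q∣ [] [] = refl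
∣p∪q∣≡∣p─q∣+∣q∣ (inside ∷ p) (inside ∷ q) =
  trans (cong suc (∣p∪q∣≡∣p─q∣+∣q∣ p q)) (sym (+-suc ∣ p ─ q ∣ ∣ q ∣))
∣p∪q∣≡∣p─q∣+∣q∣ (outside ∷ p) (inside ∷ q) =
  trans (cong suc (∣p∪q∣≡∣p─q∣+∣q∣ p q)) (sym (+-suc ∣ p ─ q ∣ ∣ q ∣))
∣p∪q∣≡∣p─q∣+∣q∣ (inside ∷ p) (outside ∷ q) = cong suc (∣p∪q∣≡∣p─q∣+∣q∣ p q)
∣p∪q∣≡∣p─q∣+∣q∣ (outside ∷ p) (outside ∷ q) = ∣p∪q∣≡∣p─q∣+∣q∣ p q

∣p∪q∣≤∣p∣+∣q∣ : ∀ {n} (p q : Subset n) → ∣ p ∪ q ∣ ≤ ∣ p ∣ + ∣ q ∣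
∣p∪q∣≤∣p∣+∣q∣ p q =
  ≤-trans (≤-reflexive (∣p∪q∣≡∣p─q∣+∣q∣ p q)) (+-monoˡ-≤ ∣ q ∣ (∣p─q∣≤∣p∣ p q))

q⊆p⇒∣p─q∣+∣q∣≤∣p∣ : ∀ {n} {p q : Subset n} → q ⊆ p → ∣ p ─ q ∣ + ∣ q ∣ ≤ ∣ p ∣
q⊆p⇒∣p─q∣+∣q∣≤∣p∣ {p = p} {q} q⊆p = begin
  ∣ p ─ q ∣ + ∣ q ∣  ≡⟨ ∣p∪q∣≡∣p─q∣+∣q∣ p q ⟨
  ∣ p ∪ q ∣          ≤⟨ p⊆q⇒∣p∣≤∣q∣ ([ id , q⊆p ] ∘ x∈p∪q⁻ p q) ⟩
  ∣ p ∣              ∎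
  where open ≤-Reasoning

∣p∣≤1+∣q∣⇒∣p─q∣≤1 : ∀ {n} {p q : Subset n} → q ⊆ p → ∣ p ∣ ≤ suc ∣ q ∣ → ∣ p ─ q ∣ ≤ 1
∣p∣≤1+∣q∣⇒∣p─q∣≤1 {q = q} q⊆p p≤1+q =
  +-cancelʳ-≤ ∣ q ∣ _ 1 (≤-trans (q⊆p⇒∣p─q∣+∣q∣≤∣p∣ q⊆p) p≤1+q)

∣p∣≤1⇒x∈p∧y∈p⇒x≡y : ∀ {n} {p : Subset n} {x y} → ∣ p ∣ ≤ 1 → x ∈ p → y ∈ p → x ≡ y
∣p∣≤1⇒x∈p∧y∈p⇒x≡y {p = p} {x} {y} ∣p∣≤1 x∈p y∈p with x ≟ y
... | yes x≡y = x≡y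
... | no x≢y = contradiction 2≤∣p∣ (≤⇒≯ ∣p∣≤1)
  where
  2≤∣p∣ : 2 ≤ ∣ p ∣
  2≤∣p∣ = ≤-trans (s≤s (≤-trans (s≤s z≤n) (x∈p⇒∣p-x∣<∣p∣ (x∈p∧x≢y⇒x∈p-y y∈p (x≢y ∘ sym)))))
                  (x∈p⇒∣p-x∣<∣p∣ x∈p)

module _ {ℓ} {n} {P : Pred (Subset n) ℓ} (P? : Decidable P) (P⊥ : P ⊥) where

  LargestSatisfying : Subset n → Set ℓ
  LargestSatisfying K = P K × (∀ K′ → P K′ → ∣ K′ ∣ ≤ ∣ K ∣)

  largestSatisfying-below : ∀ j → (∀ K → P K → ∣ K ∣ ≤ j) → Σ (Subset n) LargestSatisfying
  largestSatisfying-below j bound with anySubset? (λ K → P? K ×-dec (j ≤? ∣ K ∣))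
  ... | yes (K , PK , j≤∣K∣) = K , PK , λ K′ PK′ → ≤-trans (bound K′ PK′) j≤∣K∣
  largestSatisfying-below zero    bound | no ∄K = contradiction (⊥ , P⊥ , z≤n) ∄K
  largestSatisfying-below (suc j) bound | no ∄K =
    largestSatisfying-below j λ K PK → ≤-pred (≰⇒> λ 1+j≤∣K∣ → ∄K (K , PK , 1+j≤∣K∣))

  largestSatisfying : Σ (Subset n) LargestSatisfying
  largestSatisfying = largestSatisfying-below n (λ K _ → ∣p∣≤n K)

module _ {n} (R : Fin n → Fin n → Bool) where

  Clique : Subset n → Set
  Clique S = ∀ u v → u ∈ S → v ∈ S → u ≢ v → R u v ≡ true

  clique? : Decidable Clique
  clique? S = all? λ u → all? λ v →
    (u ∈? S) →-dec ((v ∈? S) →-dec (¬? (u ≟ v) →-dec (R u v Data.Bool.≟ true)))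

  MaximumClique : Subset n → Subset n → Set
  MaximumClique C K = K ⊆ C × Clique K × (∀ K′ → K′ ⊆ C → Clique K′ → ∣ K′ ∣ ≤ ∣ K ∣)

  ⊥-clique : Clique ⊥
  ⊥-clique _ _ u∈⊥ = contradiction u∈⊥ ∉⊥

  maximumClique : ∀ C → Σ (Subset n) (MaximumClique C)
  maximumClique C with largestSatisfying (λ K → (K ⊆? C) ×-dec clique? K) (⊥⊆ , ⊥-clique)
  ... | K , (K⊆C , cliqueK) , largest =
    K , K⊆C , cliqueK , λ K′ K′⊆C cliqueK′ → largest K′ (K′⊆C , cliqueK′)

deg≤maxDegree : ∀ {n} (G : Graph n) v → deg G v ≤ maxDegree G
deg≤maxDegree G = ≤foldr-⊔ (deg G)
  where
  ≤foldr-⊔ : ∀ {m} (f : Fin m → ℕ) i → f i ≤ foldr (λ _ → ℕ) _⊔_ 0 (tabulate f)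
  ≤foldr-⊔ f zero    = m≤m⊔n (f zero) _
  ≤foldr-⊔ f (suc i) = ≤-trans (≤foldr-⊔ (f ∘ suc) i) (m≤n⊔m (f zero) _)

∈cluster⇒label≡ : ∀ {n k} (label : Labelling n k) {i v} → v ∈ cluster label i → label v ≡ just i
∈cluster⇒label≡ label {i} {v} v∈C =
  labelIs-true (label v)
    (trans (sym (lookup-fromPred (λ u → labelIs (label u) i) v)) ([]=⇒lookup v∈C))
  where
  labelIs-true : ∀ l → labelIs l i ≡ true → l ≡ just i
  labelIs-true (just j) _ with j ≟ i
  labelIs-true (just j) _  | yes refl = refl
  labelIs-true (just j) () | no _

module _ {n} (G : Graph n) where

  lookup-N : ∀ u w → lookup (N G u) w ≡ adj G u w
  lookup-N u = lookup-fromPred (adj G u)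

  ∈N⇒adj : ∀ {u w} → w ∈ N G u → adj G u w ≡ true
  ∈N⇒adj {u} {w} w∈N = trans (sym (lookup-N u w)) ([]=⇒lookup w∈N)

  adj⇒∈N : ∀ {u w} → adj G u w ≡ true → w ∈ N G u
  adj⇒∈N {u} {w} uw = lookup⇒[]= w (N G u) (trans (lookup-N u w) uw)

  u∉N : ∀ u → u ∉ N G u
  u∉N u u∈N with trans (sym (∈N⇒adj u∈N)) (irrefl G u)
  ... | ()

  N∩⁅u⁆-empty : ∀ u → Empty (N G u ∩ ⁅ u ⁆)
  N∩⁅u⁆-empty u (w , w∈N∩⁅u⁆) with x∈p∩q⁻ (N G u) ⁅ u ⁆ w∈N∩⁅u⁆
  ... | w∈N , w∈⁅u⁆ = u∉N u (subst (_∈ N G u) (x∈⁅y⁆⇒x≡y u w∈⁅u⁆) w∈N)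

  [C─[A∪u]]∪E≡N : ∀ C u → (C ─ (Aset G C u ∪ ⁅ u ⁆)) ∪ Eset G C u ≡ N G u
  [C─[A∪u]]∪E≡N C u = p─[[p─q∪r]∪r]∪[q─p]≡q C (N G u) ⁅ u ⁆ (N∩⁅u⁆-empty u)

  clique⊆N[_] : ∀ {K} v → IsClique G K → v ∈ K → K ⊆ N[_] G v
  clique⊆N[ v ] cliqueK v∈K {x} x∈K with x ≟ v
  ... | yes refl = x∈p∪q⁺ (inj₂ (x∈⁅x⁆ x))
  ... | no x≢v   = x∈p∪q⁺ (inj₁ (adj⇒∈N (cliqueK v x v∈K x∈K (x≢v ∘ sym))))

  Aset⊆C─K : ∀ {C K v} → K ⊆ C → IsClique G K → v ∈ K → Aset G C v ⊆ C ─ K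
  Aset⊆C─K {C} {K} {v} K⊆C cliqueK v∈K x∈A with x∈p─q⁻ C (N[_] G v) x∈A
  ... | x∈C , x∉N[v] = x∈p∧x∉q⇒x∈p─q x∈C (x∉N[v] ∘ clique⊆N[ v ] cliqueK v∈K)

  ∣E∣+∣C∣≤deg+1+∣A∣ : ∀ C v → ∣ Eset G C v ∣ + ∣ C ∣ ≤ deg G v + 1 + ∣ Aset G C v ∣
  ∣E∣+∣C∣≤deg+1+∣A∣ C v = begin
    ∣ N G v ─ C ∣ + ∣ C ∣                  ≡⟨ ∣p∪q∣≡∣p─q∣+∣q∣ (N G v) C ⟨
    ∣ N G v ∪ C ∣                         ≤⟨ p⊆q⇒∣p∣≤∣q∣ N∪C⊆N[v]∪A ⟩
    ∣ N[_] G v ∪ A ∣                       ≤⟨ ∣p∪q∣≤∣p∣+∣q∣ (N[_] G v) A ⟩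
    ∣ N G v ∪ ⁅ v ⁆ ∣ + ∣ A ∣               ≤⟨ +-monoˡ-≤ ∣ A ∣ (∣p∪q∣≤∣p∣+∣q∣ (N G v) ⁅ v ⁆) ⟩
    deg G v + ∣ ⁅ v ⁆ ∣ + ∣ A ∣             ≡⟨ cong (λ m → deg G v + m + ∣ A ∣) (∣⁅x⁆∣≡1 v) ⟩
    deg G v + 1 + ∣ A ∣                   ∎
    where
    open ≤-Reasoning
    A : Subset n
    A = Aset G C v
    N∪C⊆N[v]∪A : N G v ∪ C ⊆ N[_] G v ∪ A
    N∪C⊆N[v]∪A {x} x∈N∪C with x∈p∪q⁻ (N G v) C x∈N∪C
    ... | inj₁ x∈N = x∈p∪q⁺ (inj₁ (x∈p∪q⁺ (inj₁ x∈N)))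
    ... | inj₂ x∈C with x ∈? N[_] G v
    ...   | yes x∈N[v] = x∈p∪q⁺ (inj₁ x∈N[v])
    ...   | no x∉N[v]  = x∈p∪q⁺ (inj₂ (x∈p∧x∉q⇒x∈p─q x∈C x∉N[v]))

  near-clique-report-size : ∀ {Δ C K v} → (∀ u → deg G u ≤ Δ) → K ⊆ C → IsClique G K →
                            ∣ C ─ K ∣ ≤ 1 → v ∈ K →
                            ∣ Aset G C v ∣ + ∣ Eset G C v ∣ + ∣ C ∣ ≤ 3 + Δ
  near-clique-report-size {Δ} {C} {K} {v} deg≤Δ K⊆C cliqueK C─K≤1 v∈K = begin
    a + e + ∣ C ∣                ≡⟨ +-assoc a e ∣ C ∣ ⟩
    a + (e + ∣ C ∣)              ≤⟨ +-monoʳ-≤ a (∣E∣+∣C∣≤deg+1+∣A∣ C v) ⟩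
    a + (deg G v + 1 + a)       ≤⟨ +-mono-≤ a≤1 (+-mono-≤ (+-monoˡ-≤ 1 (deg≤Δ v)) a≤1) ⟩
    1 + (Δ + 1 + 1)             ≡⟨ cong suc (trans (+-assoc Δ 1 1) (+-comm Δ 2)) ⟩
    3 + Δ                       ∎
    where
    open ≤-Reasoning
    a : ℕ
    a = ∣ Aset G C v ∣
    e : ℕ
    e = ∣ Eset G C v ∣
    a≤1 : a ≤ 1
    a≤1 = ≤-trans (p⊆q⇒∣p∣≤∣q∣ (Aset⊆C─K K⊆C cliqueK v∈K)) C─K≤1

Report : ℕ → Set
Report n = Fin n → Maybe (Subset n × Subset n)

Accurate : ∀ {n} → Graph n → Subset n → Report n → Subset n → Set
Accurate G C rec S = ∀ {v} → v ∈ S → rec v ≡ just (Aset G C v , Eset G C v)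

neighbourhoodFrom : ∀ {n} → Subset n → Fin n → Subset n × Subset n → Subset n
neighbourhoodFrom C u (A , E) = (C ─ (A ∪ ⁅ u ⁆)) ∪ E

reportedN : ∀ {n} → Subset n → Report n → Fin n → Subset n
reportedN C rec u = maybe′ (neighbourhoodFrom C u) ⊥ (rec u)

-- Both endpoints must confirm an edge, so it is certified once one of them reports accurately.
reportedAdj : ∀ {n} → Subset n → Report n → Fin n → Fin n → Bool
reportedAdj C rec u w = lookup (reportedN C rec u) w ∧ lookup (reportedN C rec w) u

recoveredCore : ∀ {n} → Subset n → Report n → Subset n
recoveredCore C rec = proj₁ (maximumClique (reportedAdj C rec) C)

recoveredNbhd : ∀ {n} → Subset n → Report n → Fin n → Subset n
recoveredNbhd C rec v = fromPred (λ w → lookup (reportedN C rec w) v) ∩ recoveredCore C rec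

recover : ∀ {n k} → Labelling n k → Report n → Fin k → Subset n × (Fin n → Subset n)
recover label rec i = recoveredCore (cluster label i) rec , recoveredNbhd (cluster label i) rec

module _ {n} (G : Graph n) (C : Subset n) (rec : Report n) where

  reportedN-accurate : ∀ {u} → rec u ≡ just (Aset G C u , Eset G C u) →
                       ∀ w → lookup (reportedN C rec u) w ≡ adj G u w
  reportedN-accurate {u} rec-u w = begin
    lookup (reportedN C rec u) w
      ≡⟨ cong (λ r → lookup (maybe′ (neighbourhoodFrom C u) ⊥ r) w) rec-u ⟩
    lookup (neighbourhoodFrom C u (Aset G C u , Eset G C u)) w
      ≡⟨ cong (λ S → lookup S w) ([C─[A∪u]]∪E≡N G C u) ⟩
    lookup (N G u) w
      ≡⟨ lookup-N G u w ⟩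
    adj G u w
      ∎
    where open ≡-Reasoning

  accurate-clique⇒reported-clique : ∀ {K} → Accurate G C rec K → IsClique G K →
                                    Clique (reportedAdj C rec) K
  accurate-clique⇒reported-clique acc cliqueK u w u∈K w∈K u≢w =
    cong₂ _∧_ (trans (reportedN-accurate (acc u∈K) w) (cliqueK u w u∈K w∈K u≢w))
              (trans (reportedN-accurate (acc w∈K) u) (cliqueK w u w∈K u∈K (u≢w ∘ sym)))

  reported-clique⇒clique : ∀ {K₀ K} → Accurate G C rec K₀ → ∣ C ─ K₀ ∣ ≤ 1 → K ⊆ C →
                           Clique (reportedAdj C rec) K → IsClique G K
  reported-clique⇒clique {K₀} acc C─K₀≤1 K⊆C reportedK u w u∈K w∈K u≢w
    with u ∈? K₀ | w ∈? K₀
  ... | yes u∈K₀ | _ =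
    trans (sym (reportedN-accurate (acc u∈K₀) w)) (∧-conicalˡ _ _ (reportedK u w u∈K w∈K u≢w))
  ... | no _ | yes w∈K₀ =
    trans (Graph.sym G u w)
      (trans (sym (reportedN-accurate (acc w∈K₀) u)) (∧-conicalʳ _ _ (reportedK u w u∈K w∈K u≢w)))
  ... | no u∉K₀ | no w∉K₀ = contradiction
    (∣p∣≤1⇒x∈p∧y∈p⇒x≡y C─K₀≤1 (x∈p∧x∉q⇒x∈p─q (K⊆C u∈K) u∉K₀)
                              (x∈p∧x∉q⇒x∈p─q (K⊆C w∈K) w∉K₀))
    u≢w

  maximum-reported-clique-isCore : ∀ {K₀ K} → IsCore G C K₀ → ∣ C ─ K₀ ∣ ≤ 1 →
                                   Accurate G C rec K₀ → MaximumClique (reportedAdj C rec) C K →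
                                   IsCore G C K
  maximum-reported-clique-isCore {K₀} {K}
    (K₀⊆C , cliqueK₀ , K₀-max) C─K₀≤1 acc (K⊆C , reportedK , K-max) =
    K⊆C , cliqueK , λ K′ K′⊆C cliqueK′ → ≤-trans (K₀-max K′ K′⊆C cliqueK′) ∣K₀∣≤∣K∣
    where
    cliqueK : IsClique G K
    cliqueK = reported-clique⇒clique acc C─K₀≤1 K⊆C reportedK
    ∣K₀∣≤∣K∣ : ∣ K₀ ∣ ≤ ∣ K ∣
    ∣K₀∣≤∣K∣ = K-max K₀ K₀⊆C (accurate-clique⇒reported-clique acc cliqueK₀)

  reportedNbhd-accurate : ∀ {S} → Accurate G C rec S → ∀ v →
                          fromPred (λ w → lookup (reportedN C rec w) v) ∩ S ≡ N G v ∩ S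
  reportedNbhd-accurate {S} acc v = ∩-cong-on _ (N G v) S λ {w} w∈S → begin
    lookup (fromPred (λ u → lookup (reportedN C rec u) v)) w  ≡⟨ lookup-fromPred _ w ⟩
    lookup (reportedN C rec w) v                             ≡⟨ reportedN-accurate (acc w∈S) v ⟩
    adj G w v                                                ≡⟨ Graph.sym G w v ⟩
    adj G v w                                                ≡⟨ lookup-N G v w ⟨
    lookup (N G v) w                                         ∎
    where open ≡-Reasoning

  recovery-correct : (∀ {K} → K ⊆ C → IsClique G K → ∣ C ─ K ∣ ≤ 1 → Accurate G C rec K) →
                     ∀ {K₀} → IsCore G C K₀ → ∣ C ∣ ≤ suc ∣ K₀ ∣ →
                     IsCore G C (recoveredCore C rec)
                       × (∀ v → recoveredNbhd C rec v ≡ N G v ∩ recoveredCore C rec)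
  recovery-correct accurate {K₀} core₀@(K₀⊆C , cliqueK₀ , _) ∣C∣≤1+∣K₀∣ =
    core , reportedNbhd-accurate (accurate K⊆C cliqueK C─K≤1)
    where
    K : Subset n
    K = recoveredCore C rec
    C─K₀≤1 : ∣ C ─ K₀ ∣ ≤ 1
    C─K₀≤1 = ∣p∣≤1+∣q∣⇒∣p─q∣≤1 K₀⊆C ∣C∣≤1+∣K₀∣
    core : IsCore G C K
    core = maximum-reported-clique-isCore core₀ C─K₀≤1 (accurate K₀⊆C cliqueK₀ C─K₀≤1)
             (proj₂ (maximumClique (reportedAdj C rec) C))
    K⊆C : K ⊆ C
    K⊆C = proj₁ core
    cliqueK : IsClique G K
    cliqueK = proj₁ (proj₂ core)
    C─K≤1 : ∣ C ─ K ∣ ≤ 1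
    C─K≤1 = ∣p∣≤1+∣q∣⇒∣p─q∣≤1 K⊆C
              (≤-trans ∣C∣≤1+∣K₀∣ (s≤s (proj₂ (proj₂ core) K₀ K₀⊆C cliqueK₀)))

critical⇒near-cliques-accurate :
  ∀ {n k} {ρ : ℚ} (G : Graph n) (label : Labelling n k) (rec : Report n) (i : Fin k) →
  Recovered G label ρ rec → Critical G (maxDegree G) ρ (cluster label i) →
  ∀ {K} → K ⊆ cluster label i → IsClique G K → ∣ cluster label i ─ K ∣ ≤ 1 →
  Accurate G (cluster label i) rec K
critical⇒near-cliques-accurate G label rec i recovered (notLarge , notSmall)
                               K⊆C cliqueK C─K≤1 v∈K =
  recovered _ i (∈cluster⇒label≡ label (K⊆C v∈K))
    (≤deficit+2⇒≤4ρ notLarge notSmall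
      (near-clique-report-size G (deg≤maxDegree G) K⊆C cliqueK C─K≤1 v∈K))

¬solitary⇒∣C∣≤1+∣core∣ : ∀ {n} (G : Graph n) {C K} → ¬ Solitary G C → IsCore G C K →
                         ∣ C ∣ ≤ suc ∣ K ∣
¬solitary⇒∣C∣≤1+∣core∣ G {C} {K} notSolitary coreK =
  ≤-pred (subst (∣ C ∣ <_) (+-comm ∣ K ∣ 2)
    (≰⇒> λ ∣K∣+2≤∣C∣ → notSolitary (K , coreK , ∣K∣+2≤∣C∣)))

corollary4p9 :
    (n k : ℕ) (ε η δ ρ : ℚ) →
    0ℚ ℚ.< ε → ε ℚ.< 1ℚ → 0ℚ ℚ.< η → η ℚ.< 1ℚ → 0ℚ ℚ.< δ → δ ℚ.< 1ℚ →
    Σ (Labelling n k → (Fin n → Maybe (Subset n × Subset n)) → Fin k →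
         Subset n × (Fin n → Subset n)) λ recover →
      (G : Graph n) (label : Labelling n k)
      (rec : Fin n → Maybe (Subset n × Subset n)) (i : Fin k) →
      IsACD G (maxDegree G) η ε δ label →
      Recovered G label ρ rec →
      Critical G (maxDegree G) ρ (cluster label i) →
      ¬ Solitary G (cluster label i) →
      IsCore G (cluster label i) (proj₁ (recover label rec i))
        × ((v : Fin n) → proj₂ (recover label rec i) v ≡ N G v ∩ proj₁ (recover label rec i))
corollary4p9 n k ε η δ ρ _ _ _ _ _ _ =
  recover , λ G label rec i _ recovered critical notSolitary →
  let C = cluster label i
      K₀ , core₀ = maximumClique (adj G) C
  in recovery-correct G C rec (critical⇒near-cliques-accurate G label rec i recovered critical)
       core₀ (¬solitary⇒∣C∣≤1+∣core∣ G notSolitary core₀)
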